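{- Let $q$ be an odd prime power. For every proper conic $C$ in $PG(2,q)$ there exists a proper conic $\tilde C$ such that $C$ and $\tilde C$ are not simultaneously diagonalizable.
   Context: $PG(2,q)$ is the projective plane over $GF(q)$. A conic is the zero set $\mathbb{V}(E)$ in $PG(2,q)$ of a nonzero quadratic form $E=ax^2+by^2+cz^2+dxy+exz+fyz$ over $GF(q)$; it is proper if its symmetric matrix (diagonal $2a,2b,2c$, off-diagonal $d,e,f$) is nonsingular. Two conics $\mathbb{V}(E_1),\mathbb{V}(E_2)$ are simultaneously diagonalizable if there is an invertible $3\times3$ matrix $S$ over $GF(q)$ such that both forms $v\mapsto E_1(Sv)$ and $v\mapsto E_2(Sv)$ have zero coefficients of $xy,xz,yz$ (equivalently $S^TA_1S$ and $S^TA_2S$ are diagonal, $A_i$ the matrix of $E_i$). -}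

module Defs where

open import Level using (Level; _⊔_)
open import Algebra.Bundles using (CommutativeRing)
open import Data.Nat using (ℕ; suc; _^_; _≡ᵇ_)
open import Data.Nat.Primality using (Prime)
open import Data.Fin using (Fin; zero; suc)
open import Data.Product using (Σ; ∃; _×_; _,_)
open import Relation.Nullary using (¬_)
open import Relation.Binary.PropositionalEquality using (_≡_)

OddPrimePower : ℕ → Set
OddPrimePower q = Σ ℕ λ p → Σ ℕ λ k → Prime p × ¬ (p ≡ 2) × q ≡ p ^ suc k

module _ {c ℓ : Level} (R : CommutativeRing c ℓ) where
  open CommutativeRing R hiding (zero)

  record IsField : Set (c ⊔ ℓ) where
    field
      1≉0     : ¬ (1# ≈ 0#)
      inverse : ∀ x → ¬ (x ≈ 0#) → ∃ λ y → x * y ≈ 1#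

  HasSize : ℕ → Set (c ⊔ ℓ)
  HasSize q = Σ (Fin q → Carrier) λ enum →
                (∀ i j → enum i ≈ enum j → i ≡ j) × (∀ x → ∃ λ i → enum i ≈ x)

  Mat3 : Set c
  Mat3 = Fin 3 → Fin 3 → Carrier

  sum3 : (Fin 3 → Carrier) → Carrier
  sum3 f = f zero + (f (suc zero) + f (suc (suc zero)))

  _⊗_ : Mat3 → Mat3 → Mat3
  (A ⊗ B) i j = sum3 λ k → A i k * B k j

  transpose : Mat3 → Mat3
  transpose A i j = A j i

  idMat : Mat3
  idMat zero zero = 1#
  idMat (suc zero) (suc zero) = 1#
  idMat (suc (suc zero)) (suc (suc zero)) = 1#
  idMat _ _ = 0#

  _≈M_ : Mat3 → Mat3 → Set ℓ
  A ≈M B = ∀ i j → A i j ≈ B i j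

  det3 : Mat3 → Carrier
  det3 A = a₁₁ * (a₂₂ * a₃₃ - a₂₃ * a₃₂)
         - a₁₂ * (a₂₁ * a₃₃ - a₂₃ * a₃₁)
         + a₁₃ * (a₂₁ * a₃₂ - a₂₂ * a₃₁)
    where
      i1 i2 i3 : Fin 3
      i1 = zero
      i2 = suc zero
      i3 = suc (suc zero)
      a₁₁ = A i1 i1
      a₁₂ = A i1 i2
      a₁₃ = A i1 i3
      a₂₁ = A i2 i1
      a₂₂ = A i2 i2
      a₂₃ = A i2 i3
      a₃₁ = A i3 i1
      a₃₂ = A i3 i2
      a₃₃ = A i3 i3

  Invertible : Mat3 → Set (c ⊔ ℓ)
  Invertible S = ∃ λ T → (S ⊗ T) ≈M idMat × (T ⊗ S) ≈M idMat

  IsDiagonal : Mat3 → Set ℓ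
  IsDiagonal A = ∀ i j → ¬ (i ≡ j) → A i j ≈ 0#

  -- Ternary quadratic form E = a x² + b y² + c z² + d xy + e xz + f yz
  record QForm : Set c where
    constructor qform
    field
      a b c' d e f : Carrier

  matrix : QForm → Mat3
  matrix (qform a b c' d e f) = M
    where
      M : Mat3
      M zero zero = a + a
      M zero (suc zero) = d
      M zero (suc (suc zero)) = e
      M (suc zero) zero = d
      M (suc zero) (suc zero) = b + b
      M (suc zero) (suc (suc zero)) = f
      M (suc (suc zero)) zero = e
      M (suc (suc zero)) (suc zero) = f
      M (suc (suc zero)) (suc (suc zero)) = c' + c'

  -- A conic V(E) is proper if the matrix of E is nonsingular
  -- (this also forces E to be a nonzero form).
  Proper : QForm → Set ℓ
  Proper E = ¬ (det3 (matrix E) ≈ 0#)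

  SimDiag : QForm → QForm → Set (c ⊔ ℓ)
  SimDiag E₁ E₂ = ∃ λ S → Invertible S
                × IsDiagonal (transpose S ⊗ (matrix E₁ ⊗ S))
                × IsDiagonal (transpose S ⊗ (matrix E₂ ⊗ S))

-- A proper conic V(E) over a finite field has a point u: completing squares reduces
-- this to the universality of a binary form α x² + β y², which is a pigeonhole argument.
-- Let A be the matrix of E and w = A u. The form E + (wᵀx)² has matrix A + 2wwᵀ, and
-- det (A + 2wwᵀ) = det A + 2 det A · uᵀAu = det A since uᵀAu = 2 E(u) = 0, so it is proper.
-- If S diagonalized both forms, then with P = SᵀAS and x = S⁻¹u the diagonal matrix
-- P + 2(Px)(Px)ᵀ forces x onto a coordinate axis, while xᵀPx = uᵀAu = 0; as the diagonal
-- entries of P are nonzero, x = 0 and so u = 0.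

module Submission where

open import Defs
open import Level using (Level; _⊔_)
open import Algebra.Bundles using (CommutativeRing)
open import Data.Empty using (⊥; ⊥-elim)
open import Data.Fin as Fin using (Fin; zero; suc)
import Data.Fin.Properties as FinP
open import Data.Integer as ℤ using (ℤ; +_; -[1+_]; _⊖_)
import Data.Integer.Properties as ℤ
open import Data.Maybe using (Maybe; just; nothing)
open import Data.Nat as ℕ using (ℕ)
import Data.Nat.Properties as ℕ
open import Data.Product using (Σ; ∃; ∃₂; _×_; _,_; proj₁; proj₂)
open import Data.Sign as Sign using (Sign)
open import Data.Sum as Sum using (_⊎_; inj₁; inj₂; [_,_]′)
open import Function using (id)
open import Relation.Binary.Definitions using (Decidable)
open import Relation.Binary.PropositionalEquality as ≡ using (_≡_)
open import Relation.Nullary using (¬_; Dec; yes; no)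
import Relation.Nullary.Decidable as Dec

module IntegerCoefficientRingSolver {c ℓ : Level} (R : CommutativeRing c ℓ) where

  open CommutativeRing R
  open import Algebra.Properties.Ring ring using (-0#≈0#; -‿+-comm; -‿involutive; -1*x≈-x)
  open import Algebra.Solver.Ring.AlmostCommutativeRing
    using (_-Raw-AlmostCommutative⟶_; fromCommutativeRing)
  open import Relation.Binary.Reasoning.Setoid setoid

  -- Not the library's n × 1#: nat 1 and nat 2 must unfold to 1# and 1# + 1#,
  -- so that solver goals match statements written with 1# and two.
  nat : ℕ → Carrier
  nat ℕ.zero                = 0#
  nat (ℕ.suc ℕ.zero)        = 1#
  nat (ℕ.suc (ℕ.suc n))     = 1# + nat (ℕ.suc n)

  nat-suc : ∀ n → nat (ℕ.suc n) ≈ 1# + nat n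
  nat-suc ℕ.zero    = sym (+-identityʳ 1#)
  nat-suc (ℕ.suc n) = refl

  nat-+ : ∀ m n → nat (m ℕ.+ n) ≈ nat m + nat n
  nat-+ ℕ.zero    n = sym (+-identityˡ _)
  nat-+ (ℕ.suc m) n = begin
    nat (ℕ.suc (m ℕ.+ n))  ≈⟨ nat-suc (m ℕ.+ n) ⟩
    1# + nat (m ℕ.+ n)     ≈⟨ +-congˡ (nat-+ m n) ⟩
    1# + (nat m + nat n)   ≈⟨ +-assoc _ _ _ ⟨
    (1# + nat m) + nat n   ≈⟨ +-congʳ (nat-suc m) ⟨
    nat (ℕ.suc m) + nat n  ∎

  nat-* : ∀ m n → nat (m ℕ.* n) ≈ nat m * nat n
  nat-* ℕ.zero    n = sym (zeroˡ _)
  nat-* (ℕ.suc m) n = begin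
    nat (n ℕ.+ m ℕ.* n)         ≈⟨ nat-+ n (m ℕ.* n) ⟩
    nat n + nat (m ℕ.* n)       ≈⟨ +-congˡ (nat-* m n) ⟩
    nat n + nat m * nat n       ≈⟨ +-congʳ (*-identityˡ _) ⟨
    1# * nat n + nat m * nat n  ≈⟨ distribʳ _ _ _ ⟨
    (1# + nat m) * nat n        ≈⟨ *-congʳ (nat-suc m) ⟨
    nat (ℕ.suc m) * nat n       ∎

  int : ℤ → Carrier
  int (+ n)    = nat n
  int -[1+ n ] = - nat (ℕ.suc n)

  a+x-[a+y]≈x-y : ∀ a x y → (a + x) - (a + y) ≈ x - y
  a+x-[a+y]≈x-y a x y = begin
    (a + x) + - (a + y)    ≈⟨ +-congˡ (-‿+-comm a y) ⟨
    (a + x) + (- a + - y)  ≈⟨ +-congʳ (+-comm a x) ⟩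
    (x + a) + (- a + - y)  ≈⟨ +-assoc x a _ ⟩
    x + (a + (- a + - y))  ≈⟨ +-congˡ (+-assoc a (- a) (- y)) ⟨
    x + ((a + - a) + - y)  ≈⟨ +-congˡ (+-congʳ (-‿inverseʳ a)) ⟩
    x + (0# + - y)         ≈⟨ +-congˡ (+-identityˡ (- y)) ⟩
    x - y                  ∎

  int-⊖ : ∀ m n → int (m ⊖ n) ≈ nat m - nat n
  int-⊖ ℕ.zero    ℕ.zero    = sym (-‿inverseʳ 0#)
  int-⊖ ℕ.zero    (ℕ.suc n) = sym (+-identityˡ _)
  int-⊖ (ℕ.suc m) ℕ.zero    = sym (trans (+-congˡ -0#≈0#) (+-identityʳ _))
  int-⊖ (ℕ.suc m) (ℕ.suc n) = begin
    int (ℕ.suc m ⊖ ℕ.suc n)        ≡⟨ ≡.cong int (ℤ.[1+m]⊖[1+n]≡m⊖n m n) ⟩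
    int (m ⊖ n)                    ≈⟨ int-⊖ m n ⟩
    nat m - nat n                  ≈⟨ a+x-[a+y]≈x-y 1# (nat m) (nat n) ⟨
    (1# + nat m) - (1# + nat n)    ≈⟨ +-cong (nat-suc m) (-‿cong (nat-suc n)) ⟨
    nat (ℕ.suc m) - nat (ℕ.suc n)  ∎

  int-+ : ∀ i j → int (i ℤ.+ j) ≈ int i + int j
  int-+ -[1+ m ] -[1+ n ] = begin
    - nat (ℕ.suc (ℕ.suc (m ℕ.+ n)))    ≡⟨ ≡.cong (λ k → - nat (ℕ.suc k)) (ℕ.+-suc m n) ⟨
    - nat (ℕ.suc m ℕ.+ ℕ.suc n)        ≈⟨ -‿cong (nat-+ (ℕ.suc m) (ℕ.suc n)) ⟩
    - (nat (ℕ.suc m) + nat (ℕ.suc n))  ≈⟨ -‿+-comm _ _ ⟨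
    - nat (ℕ.suc m) + - nat (ℕ.suc n)  ∎
  int-+ -[1+ m ] (+ n)    = trans (int-⊖ n (ℕ.suc m)) (+-comm _ _)
  int-+ (+ m)    -[1+ n ] = int-⊖ m (ℕ.suc n)
  int-+ (+ m)    (+ n)    = nat-+ m n

  sign : Sign → Carrier
  sign Sign.+ = 1#
  sign Sign.- = - 1#

  sign-* : ∀ s t → sign (s Sign.* t) ≈ sign s * sign t
  sign-* Sign.+ t      = sym (*-identityˡ _)
  sign-* Sign.- Sign.+ = sym (*-identityʳ _)
  sign-* Sign.- Sign.- = sym (trans (-1*x≈-x _) (-‿involutive _))

  int-◃ : ∀ s n → int (s ℤ.◃ n) ≈ sign s * nat n
  int-◃ s      ℕ.zero    = sym (zeroʳ _)
  int-◃ Sign.+ (ℕ.suc n) = sym (*-identityˡ _)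
  int-◃ Sign.- (ℕ.suc n) = sym (-1*x≈-x _)

  int-sign-abs : ∀ i → int i ≈ sign (ℤ.sign i) * nat ℤ.∣ i ∣
  int-sign-abs i = ≡.subst (λ k → int k ≈ sign (ℤ.sign i) * nat ℤ.∣ i ∣) (ℤ.◃-inverse i) (int-◃ (ℤ.sign i) ℤ.∣ i ∣)

  int-* : ∀ i j → int (i ℤ.* j) ≈ int i * int j
  int-* i j = begin
    int (i ℤ.* j)                        ≈⟨ int-◃ (s Sign.* t) (m ℕ.* n) ⟩
    sign (s Sign.* t) * nat (m ℕ.* n)    ≈⟨ *-cong (sign-* s t) (nat-* m n) ⟩
    (sign s * sign t) * (nat m * nat n)  ≈⟨ *-assoc _ _ _ ⟩
    sign s * (sign t * (nat m * nat n))  ≈⟨ *-congˡ (x*[y*z]≈y*[x*z] _ _ _) ⟩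
    sign s * (nat m * (sign t * nat n))  ≈⟨ *-assoc _ _ _ ⟨
    (sign s * nat m) * (sign t * nat n)  ≈⟨ *-cong (int-sign-abs i) (int-sign-abs j) ⟨
    int i * int j                        ∎
    where
    s t : Sign
    s = ℤ.sign i ; t = ℤ.sign j
    m n : ℕ
    m = ℤ.∣ i ∣ ; n = ℤ.∣ j ∣
    x*[y*z]≈y*[x*z] : ∀ x y z → x * (y * z) ≈ y * (x * z)
    x*[y*z]≈y*[x*z] x y z = trans (sym (*-assoc x y z)) (trans (*-congʳ (*-comm x y)) (*-assoc y x z))

  int-‿ : ∀ i → int (ℤ.- i) ≈ - int i
  int-‿ -[1+ n ]    = sym (-‿involutive _)
  int-‿ (+ ℕ.zero)  = sym -0#≈0#
  int-‿ (+ ℕ.suc n) = refl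

  ℤ⟶R : ℤ.+-*-rawRing -Raw-AlmostCommutative⟶ fromCommutativeRing R
  ℤ⟶R = record
    { ⟦_⟧ = int ; +-homo = int-+ ; *-homo = int-* ; -‿homo = int-‿
    ; 0-homo = refl ; 1-homo = refl }

  int-≟ : ∀ i j → Maybe (int i ≈ int j)
  int-≟ i j with i ℤ.≟ j
  ... | yes ≡.refl = just refl
  ... | no _       = nothing

  open import Algebra.Solver.Ring ℤ.+-*-rawRing (fromCommutativeRing R) ℤ⟶R int-≟ public
    using (Polynomial; con; _:+_; _:*_; :-_; _:-_; solve; _:=_)

module TernaryForms {c ℓ : Level} (R : CommutativeRing c ℓ) where

  open CommutativeRing R hiding (zero)
  open IntegerCoefficientRingSolver R
  open import Relation.Binary.Reasoning.Setoid setoid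

  Vec3 : Set c
  Vec3 = Fin 3 → Carrier

  vec3 : ∀ {a} {A : Set a} → A → A → A → Fin 3 → A
  vec3 x y z zero             = x
  vec3 x y z (suc zero)       = y
  vec3 x y z (suc (suc zero)) = z

  infixr 8 _⊛_

  _⊛_ : Mat3 R → Vec3 → Vec3
  (M ⊛ x) i = sum3 R λ k → M i k * x k

  ⟨_,_⟩ : Vec3 → Vec3 → Carrier
  ⟨ x , y ⟩ = sum3 R λ k → x k * y k

  two four : Carrier
  two  = 1# + 1#
  four = two * two

  Nonzero : Vec3 → Set ℓ
  Nonzero u = ¬ (∀ i → u i ≈ 0#)

  value : QForm R → Vec3 → Carrier
  value (qform a b c' d e f) u =
    a * (x * x) + b * (y * y) + c' * (z * z) + d * (x * y) + e * (x * z) + f * (y * z)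
    where
    x y z : Carrier
    x = u zero ; y = u (suc zero) ; z = u (suc (suc zero))

  -- The form E + (w₀x + w₁y + w₂z)², whose matrix is matrix E + 2wwᵀ.
  addSquare : QForm R → Vec3 → QForm R
  addSquare (qform a b c' d e f) w =
    qform (a + x * x) (b + y * y) (c' + z * z) (d + two * (x * y)) (e + two * (x * z)) (f + two * (y * z))
    where
    x y z : Carrier
    x = w zero ; y = w (suc zero) ; z = w (suc (suc zero))

  adjugate : Mat3 R → Mat3 R
  adjugate M = vec3 (vec3 (m₁₁ * m₂₂ - m₁₂ * m₂₁) (m₀₂ * m₂₁ - m₀₁ * m₂₂) (m₀₁ * m₁₂ - m₀₂ * m₁₁))
                    (vec3 (m₁₂ * m₂₀ - m₁₀ * m₂₂) (m₀₀ * m₂₂ - m₀₂ * m₂₀) (m₀₂ * m₁₀ - m₀₀ * m₁₂))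
                    (vec3 (m₁₀ * m₂₁ - m₁₁ * m₂₀) (m₀₁ * m₂₀ - m₀₀ * m₂₁) (m₀₀ * m₁₁ - m₀₁ * m₁₀))
    where
    m₀₀ m₀₁ m₀₂ m₁₀ m₁₁ m₁₂ m₂₀ m₂₁ m₂₂ : Carrier
    m₀₀ = M zero zero       ; m₀₁ = M zero (suc zero)       ; m₀₂ = M zero (suc (suc zero))
    m₁₀ = M (suc zero) zero ; m₁₁ = M (suc zero) (suc zero) ; m₁₂ = M (suc zero) (suc (suc zero))
    m₂₀ = M (suc (suc zero)) zero ; m₂₁ = M (suc (suc zero)) (suc zero)
    m₂₂ = M (suc (suc zero)) (suc (suc zero))

  -- Copies of the definitions above on solver syntax; ⟦_⟧ maps each copy
  -- definitionally to the original, so identities about them are solver goals.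
  private module Syntax {n : ℕ} where
    P : Set
    P = Polynomial n

    sum3ᴾ : (Fin 3 → P) → P
    sum3ᴾ f = f zero :+ (f (suc zero) :+ f (suc (suc zero)))

    infixr 8 _⊛ᴾ_

    _⊛ᴾ_ : (Fin 3 → Fin 3 → P) → (Fin 3 → P) → Fin 3 → P
    (M ⊛ᴾ x) i = sum3ᴾ λ k → M i k :* x k

    _⊗ᴾ_ : (Fin 3 → Fin 3 → P) → (Fin 3 → Fin 3 → P) → Fin 3 → Fin 3 → P
    (M ⊗ᴾ N) i j = sum3ᴾ λ k → M i k :* N k j

    ⟨_,_⟩ᴾ : (Fin 3 → P) → (Fin 3 → P) → P
    ⟨ x , y ⟩ᴾ = sum3ᴾ λ k → x k :* y k

    mat3 : P → P → P → P → P → P → P → P → P → Fin 3 → Fin 3 → P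
    mat3 m₀₀ m₀₁ m₀₂ m₁₀ m₁₁ m₁₂ m₂₀ m₂₁ m₂₂ = vec3 (vec3 m₀₀ m₀₁ m₀₂) (vec3 m₁₀ m₁₁ m₁₂) (vec3 m₂₀ m₂₁ m₂₂)

    det3ᴾ : (Fin 3 → Fin 3 → P) → P
    det3ᴾ M = M zero zero :* (M (suc zero) (suc zero) :* M (suc (suc zero)) (suc (suc zero))
                                :- M (suc zero) (suc (suc zero)) :* M (suc (suc zero)) (suc zero))
            :- M zero (suc zero) :* (M (suc zero) zero :* M (suc (suc zero)) (suc (suc zero))
                                       :- M (suc zero) (suc (suc zero)) :* M (suc (suc zero)) zero)
            :+ M zero (suc (suc zero)) :* (M (suc zero) zero :* M (suc (suc zero)) (suc zero)
                                             :- M (suc zero) (suc zero) :* M (suc (suc zero)) zero)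

    adjugateᴾ : (Fin 3 → Fin 3 → P) → Fin 3 → Fin 3 → P
    adjugateᴾ M = vec3 (vec3 (m₁₁ :* m₂₂ :- m₁₂ :* m₂₁) (m₀₂ :* m₂₁ :- m₀₁ :* m₂₂) (m₀₁ :* m₁₂ :- m₀₂ :* m₁₁))
                       (vec3 (m₁₂ :* m₂₀ :- m₁₀ :* m₂₂) (m₀₀ :* m₂₂ :- m₀₂ :* m₂₀) (m₀₂ :* m₁₀ :- m₀₀ :* m₁₂))
                       (vec3 (m₁₀ :* m₂₁ :- m₁₁ :* m₂₀) (m₀₁ :* m₂₀ :- m₀₀ :* m₂₁) (m₀₀ :* m₁₁ :- m₀₁ :* m₁₀))
      where
      m₀₀ m₀₁ m₀₂ m₁₀ m₁₁ m₁₂ m₂₀ m₂₁ m₂₂ : P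
      m₀₀ = M zero zero       ; m₀₁ = M zero (suc zero)       ; m₀₂ = M zero (suc (suc zero))
      m₁₀ = M (suc zero) zero ; m₁₁ = M (suc zero) (suc zero) ; m₁₂ = M (suc zero) (suc (suc zero))
      m₂₀ = M (suc (suc zero)) zero ; m₂₁ = M (suc (suc zero)) (suc zero)
      m₂₂ = M (suc (suc zero)) (suc (suc zero))

    twoᴾ fourᴾ : P
    twoᴾ  = con (+ 2)
    fourᴾ = twoᴾ :* twoᴾ

    matrixᴾ : P → P → P → P → P → P → Fin 3 → Fin 3 → P
    matrixᴾ a b c' d e f = mat3 (a :+ a) d e d (b :+ b) f e f (c' :+ c')

    valueᴾ : P → P → P → P → P → P → (Fin 3 → P) → P
    valueᴾ a b c' d e f u =
      a :* (x :* x) :+ b :* (y :* y) :+ c' :* (z :* z) :+ d :* (x :* y) :+ e :* (x :* z) :+ f :* (y :* z)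
      where
      x y z : P
      x = u zero ; y = u (suc zero) ; z = u (suc (suc zero))

  open Syntax

  congruent : Mat3 R → Mat3 R → Mat3 R
  congruent S M = _⊗_ R (transpose R S) (_⊗_ R M S)

  ⊛-cong : ∀ {M N x y} → _≈M_ R M N → (∀ k → x k ≈ y k) → ∀ i → (M ⊛ x) i ≈ (N ⊛ y) i
  ⊛-cong M≈N x≈y i = +-cong (*-cong (M≈N i zero) (x≈y zero))
                       (+-cong (*-cong (M≈N i (suc zero)) (x≈y (suc zero)))
                               (*-cong (M≈N i (suc (suc zero))) (x≈y (suc (suc zero)))))

  ⊛-congˡ : ∀ {M N} → _≈M_ R M N → ∀ x i → (M ⊛ x) i ≈ (N ⊛ x) i
  ⊛-congˡ M≈N x = ⊛-cong {x = x} {y = x} M≈N (λ _ → refl)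

  ⊛-congʳ : ∀ M {x y} → (∀ k → x k ≈ y k) → ∀ i → (M ⊛ x) i ≈ (M ⊛ y) i
  ⊛-congʳ M = ⊛-cong {M} {M} (λ _ _ → refl)

  ⟨⟩-congʳ : ∀ x {y z} → (∀ k → y k ≈ z k) → ⟨ x , y ⟩ ≈ ⟨ x , z ⟩
  ⟨⟩-congʳ x y≈z = ⊛-congʳ (λ _ → x) y≈z zero

  ⟨⟩-comm : ∀ x y → ⟨ x , y ⟩ ≈ ⟨ y , x ⟩
  ⟨⟩-comm x y = +-cong (*-comm _ _) (+-cong (*-comm _ _) (*-comm _ _))

  ⟨⟩-congˡ : ∀ {x y} → (∀ k → x k ≈ y k) → ∀ z → ⟨ x , z ⟩ ≈ ⟨ y , z ⟩
  ⟨⟩-congˡ {x} {y} x≈y z = trans (⟨⟩-comm x z) (trans (⟨⟩-congʳ z x≈y) (⟨⟩-comm z y))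

  ⟨⟩-scaleʳ : ∀ k x y → ⟨ x , (λ i → k * y i) ⟩ ≈ k * ⟨ x , y ⟩
  ⟨⟩-scaleʳ k x y = solve 7
    (λ k x₀ x₁ x₂ y₀ y₁ y₂ → let x = vec3 x₀ x₁ x₂ ; y = vec3 y₀ y₁ y₂ in
      ⟨ x , (λ i → k :* y i) ⟩ᴾ := k :* ⟨ x , y ⟩ᴾ)
    refl k (x zero) (x (suc zero)) (x (suc (suc zero))) (y zero) (y (suc zero)) (y (suc (suc zero)))

  ⊛-zeroʳ : ∀ M i → (M ⊛ (λ _ → 0#)) i ≈ 0#
  ⊛-zeroʳ M i = solve 3 (λ m₀ m₁ m₂ → ⟨ vec3 m₀ m₁ m₂ , (λ _ → con (+ 0)) ⟩ᴾ := con (+ 0))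
    refl (M i zero) (M i (suc zero)) (M i (suc (suc zero)))

  idMat-⊛ : ∀ x i → (idMat R ⊛ x) i ≈ x i
  idMat-⊛ x i = identity i
    where
    x₀ x₁ x₂ : Carrier
    x₀ = x zero ; x₁ = x (suc zero) ; x₂ = x (suc (suc zero))
    identity : ∀ i → (idMat R ⊛ x) i ≈ x i
    identity zero = solve 3 (λ x₀ x₁ x₂ → ⟨ vec3 (con (+ 1)) (con (+ 0)) (con (+ 0)) , vec3 x₀ x₁ x₂ ⟩ᴾ := x₀) refl x₀ x₁ x₂
    identity (suc zero) = solve 3 (λ x₀ x₁ x₂ → ⟨ vec3 (con (+ 0)) (con (+ 1)) (con (+ 0)) , vec3 x₀ x₁ x₂ ⟩ᴾ := x₁) refl x₀ x₁ x₂
    identity (suc (suc zero)) = solve 3 (λ x₀ x₁ x₂ → ⟨ vec3 (con (+ 0)) (con (+ 0)) (con (+ 1)) , vec3 x₀ x₁ x₂ ⟩ᴾ := x₂) refl x₀ x₁ x₂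

  ⊛-assoc : ∀ M N x i → (_⊗_ R M N ⊛ x) i ≈ (M ⊛ N ⊛ x) i
  ⊛-assoc M N x i = solve 15
    (λ m₀ m₁ m₂ n₀₀ n₀₁ n₀₂ n₁₀ n₁₁ n₁₂ n₂₀ n₂₁ n₂₂ x₀ x₁ x₂ →
      let Mᵢ = λ _ → vec3 m₀ m₁ m₂ ; N = mat3 n₀₀ n₀₁ n₀₂ n₁₀ n₁₁ n₁₂ n₂₀ n₂₁ n₂₂ ; x = vec3 x₀ x₁ x₂ in
      ((Mᵢ ⊗ᴾ N) ⊛ᴾ x) zero := (Mᵢ ⊛ᴾ N ⊛ᴾ x) zero)
    refl (M i zero) (M i (suc zero)) (M i (suc (suc zero)))
    (N zero zero) (N zero (suc zero)) (N zero (suc (suc zero)))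
    (N (suc zero) zero) (N (suc zero) (suc zero)) (N (suc zero) (suc (suc zero)))
    (N (suc (suc zero)) zero) (N (suc (suc zero)) (suc zero)) (N (suc (suc zero)) (suc (suc zero)))
    (x zero) (x (suc zero)) (x (suc (suc zero)))

  ⟨⊛⟩-transpose : ∀ M x y → ⟨ M ⊛ x , y ⟩ ≈ ⟨ x , transpose R M ⊛ y ⟩
  ⟨⊛⟩-transpose M x y = solve 15
    (λ m₀₀ m₀₁ m₀₂ m₁₀ m₁₁ m₁₂ m₂₀ m₂₁ m₂₂ x₀ x₁ x₂ y₀ y₁ y₂ →
      let M = mat3 m₀₀ m₀₁ m₀₂ m₁₀ m₁₁ m₁₂ m₂₀ m₂₁ m₂₂ ; x = vec3 x₀ x₁ x₂ ; y = vec3 y₀ y₁ y₂ in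
      ⟨ M ⊛ᴾ x , y ⟩ᴾ := ⟨ x , (λ i j → M j i) ⊛ᴾ y ⟩ᴾ)
    refl (M zero zero) (M zero (suc zero)) (M zero (suc (suc zero)))
    (M (suc zero) zero) (M (suc zero) (suc zero)) (M (suc zero) (suc (suc zero)))
    (M (suc (suc zero)) zero) (M (suc (suc zero)) (suc zero)) (M (suc (suc zero)) (suc (suc zero)))
    (x zero) (x (suc zero)) (x (suc (suc zero))) (y zero) (y (suc zero)) (y (suc (suc zero)))

  transpose-⊗ : ∀ S T → _≈M_ R (_⊗_ R (transpose R T) (transpose R S)) (transpose R (_⊗_ R S T))
  transpose-⊗ S T i j = +-cong (*-comm _ _) (+-cong (*-comm _ _) (*-comm _ _))

  transpose-idMat : _≈M_ R (transpose R (idMat R)) (idMat R)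
  transpose-idMat zero             zero             = refl
  transpose-idMat zero             (suc zero)       = refl
  transpose-idMat zero             (suc (suc zero)) = refl
  transpose-idMat (suc zero)       zero             = refl
  transpose-idMat (suc zero)       (suc zero)       = refl
  transpose-idMat (suc zero)       (suc (suc zero)) = refl
  transpose-idMat (suc (suc zero)) zero             = refl
  transpose-idMat (suc (suc zero)) (suc zero)       = refl
  transpose-idMat (suc (suc zero)) (suc (suc zero)) = refl

  diagonal-⊛ : ∀ {D} → IsDiagonal R D → ∀ x i → (D ⊛ x) i ≈ D i i * x i
  diagonal-⊛ {D} D-diag x i = onDiagonal i
    where
    off : ∀ {i j} → ¬ i ≡ j → D i j * x j ≈ 0#
    off i≢j = trans (*-congʳ (D-diag _ _ i≢j)) (zeroˡ _)
    onDiagonal : ∀ i → (D ⊛ x) i ≈ D i i * x i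
    onDiagonal zero = begin
      D zero zero * x zero + (_ + _)  ≈⟨ +-congˡ (+-cong (off (λ ())) (off (λ ()))) ⟩
      D zero zero * x zero + (0# + 0#) ≈⟨ +-congˡ (+-identityˡ 0#) ⟩
      D zero zero * x zero + 0#        ≈⟨ +-identityʳ _ ⟩
      D zero zero * x zero             ∎
    onDiagonal (suc zero) = begin
      _ + (D (suc zero) (suc zero) * x (suc zero) + _) ≈⟨ +-cong (off (λ ())) (+-congˡ (off (λ ()))) ⟩
      0# + (D (suc zero) (suc zero) * x (suc zero) + 0#) ≈⟨ +-identityˡ _ ⟩
      D (suc zero) (suc zero) * x (suc zero) + 0#        ≈⟨ +-identityʳ _ ⟩
      D (suc zero) (suc zero) * x (suc zero)             ∎
    onDiagonal (suc (suc zero)) = begin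
      _ + (_ + D (suc (suc zero)) (suc (suc zero)) * x (suc (suc zero)))
        ≈⟨ +-cong (off (λ ())) (+-congʳ (off (λ ()))) ⟩
      0# + (0# + D (suc (suc zero)) (suc (suc zero)) * x (suc (suc zero)))
        ≈⟨ trans (+-identityˡ _) (+-identityˡ _) ⟩
      D (suc (suc zero)) (suc (suc zero)) * x (suc (suc zero)) ∎

  value-e₀ : ∀ a b c' d e f → value (qform a b c' d e f) (vec3 1# 0# 0#) ≈ a
  value-e₀ = solve 6 (λ a b c' d e f →
    valueᴾ a b c' d e f (vec3 (con (+ 1)) (con (+ 0)) (con (+ 0))) := a) refl

  -- Lagrange's completion of squares, restricted to the line (x, 1, 0) and the plane z = 1.
  completing-square-z≈0 : ∀ a b c' d e f x →
    four * a * value (qform a b c' d e f) (vec3 x 1# 0#)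
      ≈ (two * a * x + d) * (two * a * x + d) + (four * a * b - d * d)
  completing-square-z≈0 = solve 7 (λ a b c' d e f x →
    fourᴾ :* a :* valueᴾ a b c' d e f (vec3 x (con (+ 1)) (con (+ 0)))
      := (twoᴾ :* a :* x :+ d) :* (twoᴾ :* a :* x :+ d) :+ (fourᴾ :* a :* b :- d :* d)) refl

  completing-squares-z≈1 : ∀ a b c' d e f x y →
    let B = four * a * b - d * d ; C = four * a * c' - e * e ; F = four * a * f - two * d * e
        W = two * a * x + (d * y + e) ; V = two * B * y + F in
    four * four * a * B * value (qform a b c' d e f) (vec3 x y 1#)
      ≈ four * B * (W * W) + V * V + (four * B * C - F * F)
  completing-squares-z≈1 = solve 8 (λ a b c' d e f x y →
    let B = fourᴾ :* a :* b :- d :* d ; C = fourᴾ :* a :* c' :- e :* e ; F = fourᴾ :* a :* f :- twoᴾ :* d :* e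
        W = twoᴾ :* a :* x :+ (d :* y :+ e) ; V = twoᴾ :* B :* y :+ F in
    fourᴾ :* fourᴾ :* a :* B :* valueᴾ a b c' d e f (vec3 x y (con (+ 1)))
      := fourᴾ :* B :* (W :* W) :+ V :* V :+ (fourᴾ :* B :* C :- F :* F)) refl

  adjugate-⊛-⊛ : ∀ M x i → (adjugate M ⊛ M ⊛ x) i ≈ det3 R M * x i
  adjugate-⊛-⊛ M x i = cramer i
    where
    m₀₀ m₀₁ m₀₂ m₁₀ m₁₁ m₁₂ m₂₀ m₂₁ m₂₂ : Carrier
    m₀₀ = M zero zero       ; m₀₁ = M zero (suc zero)       ; m₀₂ = M zero (suc (suc zero))
    m₁₀ = M (suc zero) zero ; m₁₁ = M (suc zero) (suc zero) ; m₁₂ = M (suc zero) (suc (suc zero))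
    m₂₀ = M (suc (suc zero)) zero ; m₂₁ = M (suc (suc zero)) (suc zero)
    m₂₂ = M (suc (suc zero)) (suc (suc zero))
    x₀ x₁ x₂ : Carrier
    x₀ = x zero ; x₁ = x (suc zero) ; x₂ = x (suc (suc zero))
    cramer : ∀ i → (adjugate M ⊛ M ⊛ x) i ≈ det3 R M * x i
    cramer zero = solve 12
      (λ m₀₀ m₀₁ m₀₂ m₁₀ m₁₁ m₁₂ m₂₀ m₂₁ m₂₂ x₀ x₁ x₂ →
        let M = mat3 m₀₀ m₀₁ m₀₂ m₁₀ m₁₁ m₁₂ m₂₀ m₂₁ m₂₂ ; x = vec3 x₀ x₁ x₂ in
        (adjugateᴾ M ⊛ᴾ M ⊛ᴾ x) zero := det3ᴾ M :* x₀)
      refl m₀₀ m₀₁ m₀₂ m₁₀ m₁₁ m₁₂ m₂₀ m₂₁ m₂₂ x₀ x₁ x₂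
    cramer (suc zero) = solve 12
      (λ m₀₀ m₀₁ m₀₂ m₁₀ m₁₁ m₁₂ m₂₀ m₂₁ m₂₂ x₀ x₁ x₂ →
        let M = mat3 m₀₀ m₀₁ m₀₂ m₁₀ m₁₁ m₁₂ m₂₀ m₂₁ m₂₂ ; x = vec3 x₀ x₁ x₂ in
        (adjugateᴾ M ⊛ᴾ M ⊛ᴾ x) (suc zero) := det3ᴾ M :* x₁)
      refl m₀₀ m₀₁ m₀₂ m₁₀ m₁₁ m₁₂ m₂₀ m₂₁ m₂₂ x₀ x₁ x₂
    cramer (suc (suc zero)) = solve 12
      (λ m₀₀ m₀₁ m₀₂ m₁₀ m₁₁ m₁₂ m₂₀ m₂₁ m₂₂ x₀ x₁ x₂ →
        let M = mat3 m₀₀ m₀₁ m₀₂ m₁₀ m₁₁ m₁₂ m₂₀ m₂₁ m₂₂ ; x = vec3 x₀ x₁ x₂ in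
        (adjugateᴾ M ⊛ᴾ M ⊛ᴾ x) (suc (suc zero)) := det3ᴾ M :* x₂)
      refl m₀₀ m₀₁ m₀₂ m₁₀ m₁₁ m₁₂ m₂₀ m₂₁ m₂₂ x₀ x₁ x₂

  two*value≈⟨u,matrix⊛u⟩ : ∀ E u → two * value E u ≈ ⟨ u , matrix R E ⊛ u ⟩
  two*value≈⟨u,matrix⊛u⟩ (qform a b c' d e f) u = solve 9
    (λ a b c' d e f u₀ u₁ u₂ → let u = vec3 u₀ u₁ u₂ in
      twoᴾ :* valueᴾ a b c' d e f u := ⟨ u , matrixᴾ a b c' d e f ⊛ᴾ u ⟩ᴾ)
    refl a b c' d e f (u zero) (u (suc zero)) (u (suc (suc zero)))

  det3-matrix-even : ∀ a b c' d e f → det3 R (matrix R (qform a b c' d e f))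
    ≈ two * (four * a * b * c' + d * e * f - a * f * f - b * e * e - c' * d * d)
  det3-matrix-even = solve 6 (λ a b c' d e f →
    det3ᴾ (matrixᴾ a b c' d e f)
      := twoᴾ :* (fourᴾ :* a :* b :* c' :+ d :* e :* f :- a :* f :* f :- b :* e :* e :- c' :* d :* d))
    refl

  -- The matrix determinant lemma for the rank-one update A + 2wwᵀ.
  det3-addSquare : ∀ E w → det3 R (matrix R (addSquare E w))
                           ≈ det3 R (matrix R E) + two * ⟨ w , adjugate (matrix R E) ⊛ w ⟩
  det3-addSquare (qform a b c' d e f) w = solve 9
    (λ a b c' d e f w₀ w₁ w₂ → let w = vec3 w₀ w₁ w₂ ; A = matrixᴾ a b c' d e f in
      det3ᴾ (matrixᴾ (a :+ w₀ :* w₀) (b :+ w₁ :* w₁) (c' :+ w₂ :* w₂)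
                     (d :+ twoᴾ :* (w₀ :* w₁)) (e :+ twoᴾ :* (w₀ :* w₂)) (f :+ twoᴾ :* (w₁ :* w₂)))
        := det3ᴾ A :+ twoᴾ :* ⟨ w , adjugateᴾ A ⊛ᴾ w ⟩ᴾ)
    refl a b c' d e f (w zero) (w (suc zero)) (w (suc (suc zero)))

  congruent-addSquare : ∀ E w S i j →
    congruent S (matrix R (addSquare E w)) i j
      ≈ congruent S (matrix R E) i j + two * ((transpose R S ⊛ w) i * (transpose R S ⊛ w) j)
  congruent-addSquare (qform a b c' d e f) w S i j = solve 15
    (λ s₀ s₁ s₂ t₀ t₁ t₂ a b c' d e f w₀ w₁ w₂ →
      let s = vec3 s₀ s₁ s₂ ; t = vec3 t₀ t₁ t₂ ; w = vec3 w₀ w₁ w₂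
          B = matrixᴾ (a :+ w₀ :* w₀) (b :+ w₁ :* w₁) (c' :+ w₂ :* w₂)
                      (d :+ twoᴾ :* (w₀ :* w₁)) (e :+ twoᴾ :* (w₀ :* w₂)) (f :+ twoᴾ :* (w₁ :* w₂)) in
      ⟨ s , B ⊛ᴾ t ⟩ᴾ := ⟨ s , matrixᴾ a b c' d e f ⊛ᴾ t ⟩ᴾ :+ twoᴾ :* (⟨ s , w ⟩ᴾ :* ⟨ t , w ⟩ᴾ))
    refl (S zero i) (S (suc zero) i) (S (suc (suc zero)) i) (S zero j) (S (suc zero) j) (S (suc (suc zero)) j)
    a b c' d e f (w zero) (w (suc zero)) (w (suc (suc zero)))

  proper⇒two≉0 : ∀ E → Proper R E → ¬ two ≈ 0#
  proper⇒two≉0 (qform a b c' d e f) proper two≈0 =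
    proper (trans (det3-matrix-even a b c' d e f) (trans (*-congʳ two≈0) (zeroˡ _)))

  congruent-⊛ : ∀ S M x i → (congruent S M ⊛ x) i ≈ (transpose R S ⊛ M ⊛ S ⊛ x) i
  congruent-⊛ S M x i = trans (⊛-assoc (transpose R S) (_⊗_ R M S) x i)
                              (⊛-congʳ (transpose R S) (⊛-assoc M S x) i)

  left-inverse-⊛ : ∀ S T → _≈M_ R (_⊗_ R T S) (idMat R) → ∀ x i → (T ⊛ S ⊛ x) i ≈ x i
  left-inverse-⊛ S T TS≈I x i = begin
    (T ⊛ S ⊛ x) i         ≈⟨ ⊛-assoc T S x i ⟨
    (_⊗_ R T S ⊛ x) i     ≈⟨ ⊛-congˡ TS≈I x i ⟩
    (idMat R ⊛ x) i       ≈⟨ idMat-⊛ x i ⟩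
    x i                   ∎

  left-inverse⇒⊛-injective : ∀ S T → _≈M_ R (_⊗_ R T S) (idMat R) →
                             ∀ {x} → (∀ i → (S ⊛ x) i ≈ 0#) → ∀ i → x i ≈ 0#
  left-inverse⇒⊛-injective S T TS≈I {x} Sx≈0 i = begin
    x i                     ≈⟨ left-inverse-⊛ S T TS≈I x i ⟨
    (T ⊛ S ⊛ x) i           ≈⟨ ⊛-congʳ T {S ⊛ x} Sx≈0 i ⟩
    (T ⊛ (λ _ → 0#)) i      ≈⟨ ⊛-zeroʳ T i ⟩
    0#                      ∎

  transpose-inverse : ∀ S T → _≈M_ R (_⊗_ R S T) (idMat R) →
                      _≈M_ R (_⊗_ R (transpose R T) (transpose R S)) (idMat R)
  transpose-inverse S T ST≈I i j = trans (transpose-⊗ S T i j) (trans (ST≈I j i) (transpose-idMat i j))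

  -- w = A u is what makes the rank-one correction invisible to the determinant:
  -- wᵀ (adj A) w = uᵀ A (adj A) A u = det A · uᵀ A u.
  det3-addSquare-isotropic : ∀ E u → value E u ≈ 0# →
    det3 R (matrix R (addSquare E (matrix R E ⊛ u))) ≈ det3 R (matrix R E)
  det3-addSquare-isotropic E u isotropic = begin
    det3 R (matrix R (addSquare E w))          ≈⟨ det3-addSquare E w ⟩
    Δ + two * ⟨ w , adjugate A ⊛ w ⟩           ≈⟨ +-congˡ (*-congˡ (⟨⟩-congʳ w (adjugate-⊛-⊛ A u))) ⟩
    Δ + two * ⟨ w , (λ i → Δ * u i) ⟩          ≈⟨ +-congˡ (*-congˡ (⟨⟩-scaleʳ Δ w u)) ⟩
    Δ + two * (Δ * ⟨ w , u ⟩)                  ≈⟨ +-congˡ (*-congˡ (*-congˡ (⟨⟩-comm w u))) ⟩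
    Δ + two * (Δ * ⟨ u , w ⟩)                  ≈⟨ +-congˡ (*-congˡ (*-congˡ (two*value≈⟨u,matrix⊛u⟩ E u))) ⟨
    Δ + two * (Δ * (two * value E u))          ≈⟨ +-congˡ (*-congˡ (*-congˡ (*-congˡ isotropic))) ⟩
    Δ + two * (Δ * (two * 0#))                 ≈⟨ +-congˡ (trans (*-congˡ (trans (*-congˡ (zeroʳ two)) (zeroʳ Δ))) (zeroʳ two)) ⟩
    Δ + 0#                                     ≈⟨ +-identityʳ Δ ⟩
    Δ                                          ∎
    where
    A : Mat3 R
    A = matrix R E
    w : Vec3
    w = A ⊛ u
    Δ : Carrier
    Δ = det3 R A

module FieldProperties {c ℓ : Level} (R : CommutativeRing c ℓ) (isField : IsField R) where

  open CommutativeRing R hiding (zero)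
  open IsField isField
  open import Algebra.Properties.Ring ring using (x∙y⁻¹≈ε⇒x≈y; x[y-z]≈xy-xz)
  open import Relation.Binary.Reasoning.Setoid setoid

  x≉0∧x*y≈0⇒y≈0 : ∀ {x y} → ¬ x ≈ 0# → x * y ≈ 0# → y ≈ 0#
  x≉0∧x*y≈0⇒y≈0 {x} {y} x≉0 xy≈0 with inverse x x≉0
  ... | x⁻¹ , xx⁻¹≈1 = begin
    y              ≈⟨ *-identityˡ y ⟨
    1# * y         ≈⟨ *-congʳ xx⁻¹≈1 ⟨
    (x * x⁻¹) * y  ≈⟨ *-congʳ (*-comm x x⁻¹) ⟩
    (x⁻¹ * x) * y  ≈⟨ *-assoc x⁻¹ x y ⟩
    x⁻¹ * (x * y)  ≈⟨ *-congˡ xy≈0 ⟩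
    x⁻¹ * 0#       ≈⟨ zeroʳ x⁻¹ ⟩
    0#             ∎

  x≉0∧y≉0⇒x*y≉0 : ∀ {x y} → ¬ x ≈ 0# → ¬ y ≈ 0# → ¬ x * y ≈ 0#
  x≉0∧y≉0⇒x*y≉0 x≉0 y≉0 xy≈0 = y≉0 (x≉0∧x*y≈0⇒y≈0 x≉0 xy≈0)

  *-cancelˡ : ∀ {a x y} → ¬ a ≈ 0# → a * x ≈ a * y → x ≈ y
  *-cancelˡ {a} {x} {y} a≉0 ax≈ay = x∙y⁻¹≈ε⇒x≈y x y (x≉0∧x*y≈0⇒y≈0 a≉0 (begin
    a * (x - y)    ≈⟨ x[y-z]≈xy-xz a x y ⟩
    a * x - a * y  ≈⟨ +-congʳ ax≈ay ⟩
    a * y - a * y  ≈⟨ -‿inverseʳ (a * y) ⟩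
    0#             ∎))

  divide : ∀ {k} → ¬ k ≈ 0# → ∀ r → ∃ λ x → k * x ≈ r
  divide {k} k≉0 r with inverse k k≉0
  ... | k⁻¹ , kk⁻¹≈1 = k⁻¹ * r , trans (sym (*-assoc k k⁻¹ r)) (trans (*-congʳ kk⁻¹≈1) (*-identityˡ r))

module DecidableFieldProperties {c ℓ : Level} (R : CommutativeRing c ℓ) (isField : IsField R)
  (_≟_ : Decidable (CommutativeRing._≈_ R)) where

  open CommutativeRing R hiding (zero)
  open FieldProperties R isField
  open IntegerCoefficientRingSolver R using (solve; _:=_; _:+_; _:*_; _:-_)
  open import Algebra.Properties.Ring ring using (x∙y⁻¹≈ε⇒x≈y; +-inverseˡ-unique)
  open import Relation.Binary.Reasoning.Setoid setoid

  x*y≈0⇒x≈0⊎y≈0 : ∀ {x y} → x * y ≈ 0# → x ≈ 0# ⊎ y ≈ 0#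
  x*y≈0⇒x≈0⊎y≈0 {x} xy≈0 with x ≟ 0#
  ... | yes x≈0 = inj₁ x≈0
  ... | no  x≉0 = inj₂ (x≉0∧x*y≈0⇒y≈0 x≉0 xy≈0)

  x*x≈0⇒x≈0 : ∀ {x} → x * x ≈ 0# → x ≈ 0#
  x*x≈0⇒x≈0 xx≈0 = [ id , id ]′ (x*y≈0⇒x≈0⊎y≈0 xx≈0)

  x*[x*x]≈0⇒x≈0 : ∀ {x} → x * (x * x) ≈ 0# → x ≈ 0#
  x*[x*x]≈0⇒x≈0 xxx≈0 = [ id , x*x≈0⇒x≈0 ]′ (x*y≈0⇒x≈0⊎y≈0 xxx≈0)

  x*x≈y*y⇒x≈y⊎x≈-y : ∀ {x y} → x * x ≈ y * y → x ≈ y ⊎ x ≈ - y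
  x*x≈y*y⇒x≈y⊎x≈-y {x} {y} xx≈yy =
    Sum.map (x∙y⁻¹≈ε⇒x≈y x y) (+-inverseˡ-unique x y) (x*y≈0⇒x≈0⊎y≈0 (begin
      (x - y) * (x + y)  ≈⟨ difference-of-squares x y ⟩
      x * x - y * y      ≈⟨ +-congʳ xx≈yy ⟩
      y * y - y * y      ≈⟨ -‿inverseʳ (y * y) ⟩
      0#                 ∎))
    where
    difference-of-squares : ∀ x y → (x - y) * (x + y) ≈ x * x - y * y
    difference-of-squares = solve 2 (λ x y → (x :- y) :* (x :+ y) := x :* x :- y :* y) refl

module FiniteFieldProperties {c ℓ : Level} (R : CommutativeRing c ℓ) (isField : IsField R)
  {q : ℕ} (size : HasSize R q) where

  open CommutativeRing R hiding (zero)
  open IsField isField using (1≉0)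
  open FieldProperties R isField
  open import Algebra.Properties.Ring ring
    using (-0#≈0#; -‿involutive; -‿injective; +-cancelˡ; +-identityʳ-unique)
  open import Relation.Binary.Reasoning.Setoid setoid

  private
    x-y+y≈x : ∀ x y → (x - y) + y ≈ x
    x-y+y≈x x y = trans (+-assoc x (- y) y) (trans (+-congˡ (-‿inverseˡ y)) (+-identityʳ x))

    enum : Fin q → Carrier
    enum = proj₁ size

    enum-injective : ∀ i j → enum i ≈ enum j → i ≡ j
    enum-injective = proj₁ (proj₂ size)

  index : Carrier → Fin q
  index x = proj₁ (proj₂ (proj₂ size) x)

  enum-index : ∀ x → enum (index x) ≈ x
  enum-index x = proj₂ (proj₂ (proj₂ size) x)

  index-cong : ∀ {x y} → x ≈ y → index x ≡ index y
  index-cong {x} {y} x≈y = enum-injective _ _ (trans (enum-index x) (trans x≈y (sym (enum-index y))))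

  index-injective : ∀ {x y} → index x ≡ index y → x ≈ y
  index-injective {x} {y} eq =
    trans (sym (enum-index x)) (trans (reflexive (≡.cong enum eq)) (enum-index y))

  _≟_ : Decidable _≈_
  x ≟ y = Dec.map′ index-injective index-cong (index x Fin.≟ index y)

  open DecidableFieldProperties R isField _≟_ using (x*x≈0⇒x≈0; x*x≈y*y⇒x≈y⊎x≈-y)

  Represents : Carrier → Carrier → Carrier → Set (c ⊔ ℓ)
  Represents α β γ = ∃₂ λ x y → α * (x * x) + β * (y * y) ≈ γ

  -- Pigeonhole: the q + 1 values γ, α t² (one t from each pair ±t) and
  -- γ - β t² (the other t) cannot be pairwise distinct in a field of q elements.
  private
    module NotRepresented {α β γ : Carrier} (α≉0 : ¬ α ≈ 0#) (β≉0 : ¬ β ≈ 0#)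
      (¬represented : ∀ x y → ¬ α * (x * x) + β * (y * y) ≈ γ) where

      Canonical : Carrier → Set
      Canonical t = index t Fin.≤ index (- t)

      canonical? : ∀ t → Dec (Canonical t)
      canonical? t = index t Fin.≤? index (- t)

      index-neg : ∀ {t s} → t ≈ - s → index (- t) ≡ index s
      index-neg {t} {s} t≈-s = index-cong (trans (-‿cong t≈-s) (-‿involutive s))

      canonical-unique : ∀ {t s} → Canonical t → Canonical s → t ≈ - s → t ≈ s
      canonical-unique can-t can-s t≈-s = index-injective (FinP.≤-antisym
        (FinP.≤-trans can-t (FinP.≤-reflexive (index-neg t≈-s)))
        (FinP.≤-trans can-s (FinP.≤-reflexive (≡.sym (index-cong t≈-s)))))

      noncanonical-distinct : ∀ {t s} → ¬ Canonical t → ¬ Canonical s → ¬ t ≈ - s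
      noncanonical-distinct {t} {s} ¬can-t ¬can-s t≈-s = FinP.<-asym
        (≡.subst (Fin._< index t) (index-neg t≈-s) (ℕ.≰⇒> ¬can-t))
        (≡.subst (Fin._< index s) (≡.sym (index-cong t≈-s)) (ℕ.≰⇒> ¬can-s))

      zero-canonical : ∀ {t} → t ≈ 0# → Canonical t
      zero-canonical {t} t≈0 = FinP.≤-reflexive (index-cong (trans t≈0 (sym (trans (-‿cong t≈0) -0#≈0#))))

      image : (t : Carrier) → Dec (Canonical t) → Carrier
      image t (yes _) = α * (t * t)
      image t (no _)  = γ - β * (t * t)

      x-y≈x-z⇒y≈z : ∀ {x y z} → x - y ≈ x - z → y ≈ z
      x-y≈x-z⇒y≈z {x} eq = -‿injective (+-cancelˡ x _ _ eq)

      image≉γ : ∀ t can? → ¬ image t can? ≈ γ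
      image≉γ t (yes _) αt²≈γ = ¬represented t 0# (begin
        α * (t * t) + β * (0# * 0#)  ≈⟨ +-congˡ (trans (*-congˡ (zeroˡ 0#)) (zeroʳ β)) ⟩
        α * (t * t) + 0#             ≈⟨ +-identityʳ _ ⟩
        α * (t * t)                  ≈⟨ αt²≈γ ⟩
        γ                            ∎)
      image≉γ t (no ¬can) γ-βt²≈γ = ¬can (zero-canonical (x*x≈0⇒x≈0 (x≉0∧x*y≈0⇒y≈0 β≉0 βt²≈0)))
        where
        βt²≈0 : β * (t * t) ≈ 0#
        βt²≈0 = trans (sym (-‿involutive _)) (trans (-‿cong (+-identityʳ-unique γ _ γ-βt²≈γ)) -0#≈0#)

      image-injective : ∀ t s can-t? can-s? → image t can-t? ≈ image s can-s? → t ≈ s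
      image-injective t s (yes can-t) (yes can-s) eq with x*x≈y*y⇒x≈y⊎x≈-y (*-cancelˡ α≉0 eq)
      ... | inj₁ t≈s  = t≈s
      ... | inj₂ t≈-s = canonical-unique can-t can-s t≈-s
      image-injective t s (no ¬can-t) (no ¬can-s) eq with x*x≈y*y⇒x≈y⊎x≈-y (*-cancelˡ β≉0 (x-y≈x-z⇒y≈z eq))
      ... | inj₁ t≈s  = t≈s
      ... | inj₂ t≈-s = ⊥-elim (noncanonical-distinct ¬can-t ¬can-s t≈-s)
      image-injective t s (yes _) (no _) eq =
        ⊥-elim (¬represented t s (trans (+-congʳ eq) (x-y+y≈x γ _)))
      image-injective t s (no _) (yes _) eq =
        ⊥-elim (¬represented s t (trans (+-congʳ (sym eq)) (x-y+y≈x γ _)))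

      values : Fin (ℕ.suc q) → Fin q
      values zero    = index γ
      values (suc i) = index (image (enum i) (canonical? (enum i)))

      contradiction : ⊥
      contradiction with FinP.pigeonhole (ℕ.n<1+n q) values
      ... | zero  , suc j , _   , eq = image≉γ (enum j) (canonical? (enum j)) (sym (index-injective eq))
      ... | suc i , suc j , i<j , eq = FinP.<-irrefl
        (enum-injective i j (image-injective (enum i) (enum j) (canonical? (enum i)) (canonical? (enum j))
                                             (index-injective eq)))
        (ℕ.s<s⁻¹ i<j)

  binary-form-universal : ∀ {α β} → ¬ α ≈ 0# → ¬ β ≈ 0# → ∀ γ → Represents α β γ
  binary-form-universal {α} {β} α≉0 β≉0 γ
    with FinP.any? (λ i → FinP.any? (λ j → (α * (enum i * enum i) + β * (enum j * enum j)) ≟ γ))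
  ... | yes (i , j , represented) = enum i , enum j , represented
  ... | no ¬represented = ⊥-elim (NotRepresented.contradiction α≉0 β≉0 λ x y eq →
        ¬represented (index x , index y , trans (+-cong (*-congˡ (*-cong (enum-index x) (enum-index x)))
                                                        (*-congˡ (*-cong (enum-index y) (enum-index y)))) eq))

  open TernaryForms R

  module _ (two≉0 : ¬ two ≈ 0#) where

    private
      two*a≉0 : ∀ {a} → ¬ a ≈ 0# → ¬ two * a ≈ 0#
      two*a≉0 = x≉0∧y≉0⇒x*y≉0 two≉0

      four≉0 : ¬ four ≈ 0#
      four≉0 = x≉0∧y≉0⇒x*y≉0 two≉0 two≉0

    isotropic-with-z≈0 : ∀ a b c' d e f → ¬ a ≈ 0# → four * a * b - d * d ≈ 0# →
                         ∃ λ x → value (qform a b c' d e f) (vec3 x 1# 0#) ≈ 0#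
    isotropic-with-z≈0 a b c' d e f a≉0 B≈0 with divide (two*a≉0 a≉0) (- d)
    ... | x , two*a*x≈-d = x , x≉0∧x*y≈0⇒y≈0 (x≉0∧y≉0⇒x*y≉0 four≉0 a≉0) (begin
      four * a * value (qform a b c' d e f) (vec3 x 1# 0#)  ≈⟨ completing-square-z≈0 a b c' d e f x ⟩
      W * W + (four * a * b - d * d)                        ≈⟨ +-cong (*-cong W≈0 W≈0) B≈0 ⟩
      0# * 0# + 0#                                          ≈⟨ trans (+-identityʳ _) (zeroˡ 0#) ⟩
      0#                                                    ∎)
      where
      W : Carrier
      W = two * a * x + d
      W≈0 : W ≈ 0#
      W≈0 = trans (+-congʳ two*a*x≈-d) (-‿inverseˡ d)

    isotropic-with-z≈1 : ∀ a b c' d e f → ¬ a ≈ 0# → ¬ four * a * b - d * d ≈ 0# →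
                         ∃₂ λ x y → value (qform a b c' d e f) (vec3 x y 1#) ≈ 0#
    isotropic-with-z≈1 a b c' d e f a≉0 B≉0 = x , y , value≈0
      where
      B C F G : Carrier
      B = four * a * b - d * d ; C = four * a * c' - e * e ; F = four * a * f - two * d * e
      G = four * B * C - F * F
      represented : Represents (four * B) 1# (- G)
      represented = binary-form-universal (x≉0∧y≉0⇒x*y≉0 four≉0 B≉0) 1≉0 (- G)
      W₀ V₀ : Carrier
      W₀ = proj₁ represented
      V₀ = proj₁ (proj₂ represented)
      y-solution : ∃ λ y → two * B * y ≈ V₀ - F
      y-solution = divide (two*a≉0 B≉0) (V₀ - F)
      y : Carrier
      y = proj₁ y-solution
      x-solution : ∃ λ x → two * a * x ≈ W₀ - (d * y + e)
      x-solution = divide (two*a≉0 a≉0) (W₀ - (d * y + e))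
      x : Carrier
      x = proj₁ x-solution
      W V : Carrier
      W = two * a * x + (d * y + e)
      V = two * B * y + F
      16aB≉0 : ¬ four * four * a * B ≈ 0#
      16aB≉0 = x≉0∧y≉0⇒x*y≉0 (x≉0∧y≉0⇒x*y≉0 (x≉0∧y≉0⇒x*y≉0 four≉0 four≉0) a≉0) B≉0
      W≈W₀ : W ≈ W₀
      W≈W₀ = trans (+-congʳ (proj₂ x-solution)) (x-y+y≈x W₀ _)
      V≈V₀ : V ≈ V₀
      V≈V₀ = trans (+-congʳ (proj₂ y-solution)) (x-y+y≈x V₀ F)
      value≈0 : value (qform a b c' d e f) (vec3 x y 1#) ≈ 0#
      value≈0 = x≉0∧x*y≈0⇒y≈0 16aB≉0 (begin
        four * four * a * B * value (qform a b c' d e f) (vec3 x y 1#) ≈⟨ completing-squares-z≈1 a b c' d e f x y ⟩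
        four * B * (W * W) + V * V + G              ≈⟨ +-congʳ (+-cong (*-congˡ (*-cong W≈W₀ W≈W₀)) (*-cong V≈V₀ V≈V₀)) ⟩
        four * B * (W₀ * W₀) + V₀ * V₀ + G          ≈⟨ +-congʳ (+-congˡ (*-identityˡ _)) ⟨
        four * B * (W₀ * W₀) + 1# * (V₀ * V₀) + G   ≈⟨ +-congʳ (proj₂ (proj₂ represented)) ⟩
        - G + G                                     ≈⟨ -‿inverseˡ G ⟩
        0#                                          ∎)

    ternary-form-isotropic : ∀ E → ∃ λ u → Nonzero u × value E u ≈ 0#
    ternary-form-isotropic (qform a b c' d e f) with a ≟ 0#
    ... | yes a≈0 = vec3 1# 0# 0# , (λ u≈0 → 1≉0 (u≈0 zero)) , trans (value-e₀ a b c' d e f) a≈0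
    ... | no a≉0 with (four * a * b - d * d) ≟ 0#
    ...   | yes B≈0 = let x , isotropic = isotropic-with-z≈0 a b c' d e f a≉0 B≈0 in
                      vec3 x 1# 0# , (λ u≈0 → 1≉0 (u≈0 (suc zero))) , isotropic
    ...   | no  B≉0 = let x , y , isotropic = isotropic-with-z≈1 a b c' d e f a≉0 B≉0 in
                      vec3 x y 1# , (λ u≈0 → 1≉0 (u≈0 (suc (suc zero)))) , isotropic

module Diagonalization {c ℓ : Level} (R : CommutativeRing c ℓ) (isField : IsField R)
  (_≟_ : Decidable (CommutativeRing._≈_ R)) where

  open CommutativeRing R hiding (zero)
  open IsField isField using (1≉0)
  open TernaryForms R
  open FieldProperties R isField
  open DecidableFieldProperties R isField _≟_ using (x*[x*x]≈0⇒x≈0)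
  open IntegerCoefficientRingSolver R using (solve; _:=_; _:+_; _:*_)
  open import Algebra.Properties.CommutativeSemigroup +-commutativeSemigroup
    using (x∙yz≈y∙xz; x∙yz≈z∙xy)
  open import Algebra.Properties.CommutativeSemigroup *-commutativeSemigroup using (interchange)
  open import Relation.Binary.Reasoning.Setoid setoid

  nonsingular⇒⊛-injective : ∀ M → ¬ det3 R M ≈ 0# → ∀ {x} → (∀ i → (M ⊛ x) i ≈ 0#) → ∀ i → x i ≈ 0#
  nonsingular⇒⊛-injective M det≉0 {x} Mx≈0 i = x≉0∧x*y≈0⇒y≈0 det≉0 (begin
    det3 R M * x i                 ≈⟨ adjugate-⊛-⊛ M x i ⟨
    (adjugate M ⊛ M ⊛ x) i         ≈⟨ ⊛-congʳ (adjugate M) {M ⊛ x} Mx≈0 i ⟩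
    (adjugate M ⊛ (λ _ → 0#)) i    ≈⟨ ⊛-zeroʳ (adjugate M) i ⟩
    0#                             ∎)

  idMat-diagonal : ∀ i → idMat R i i ≈ 1#
  idMat-diagonal zero             = refl
  idMat-diagonal (suc zero)       = refl
  idMat-diagonal (suc (suc zero)) = refl

  diagonal-isotropic-on-first-axis⇒zero : ∀ {d₀ d₁ d₂ x₀ x₁ x₂} → ¬ d₀ ≈ 0# →
    x₀ * x₁ ≈ 0# → x₀ * x₂ ≈ 0# → x₀ * (d₀ * x₀) + (x₁ * (d₁ * x₁) + x₂ * (d₂ * x₂)) ≈ 0# → x₀ ≈ 0#
  diagonal-isotropic-on-first-axis⇒zero {d₀} {d₁} {d₂} {x₀} {x₁} {x₂} d₀≉0 x₀x₁≈0 x₀x₂≈0 isotropic =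
    x*[x*x]≈0⇒x≈0 (x≉0∧x*y≈0⇒y≈0 d₀≉0 (begin
      d₀ * x₀³                                              ≈⟨ +-identityʳ _ ⟨
      d₀ * x₀³ + 0#                                         ≈⟨ +-congˡ cross-terms≈0 ⟨
      d₀ * x₀³ + (d₁ * x₁ * (x₀ * x₁) + d₂ * x₂ * (x₀ * x₂))  ≈⟨ expand d₀ d₁ d₂ x₀ x₁ x₂ ⟨
      x₀ * (x₀ * (d₀ * x₀) + (x₁ * (d₁ * x₁) + x₂ * (d₂ * x₂))) ≈⟨ *-congˡ isotropic ⟩
      x₀ * 0#                                               ≈⟨ zeroʳ x₀ ⟩
      0#                                                    ∎))
    where
    x₀³ : Carrier
    x₀³ = x₀ * (x₀ * x₀)
    cross-terms≈0 : d₁ * x₁ * (x₀ * x₁) + d₂ * x₂ * (x₀ * x₂) ≈ 0#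
    cross-terms≈0 = trans (+-cong (trans (*-congˡ x₀x₁≈0) (zeroʳ _)) (trans (*-congˡ x₀x₂≈0) (zeroʳ _)))
                          (+-identityʳ 0#)
    expand : ∀ d₀ d₁ d₂ x₀ x₁ x₂ → x₀ * (x₀ * (d₀ * x₀) + (x₁ * (d₁ * x₁) + x₂ * (d₂ * x₂)))
                                   ≈ d₀ * (x₀ * (x₀ * x₀)) + (d₁ * x₁ * (x₀ * x₁) + d₂ * x₂ * (x₀ * x₂))
    expand = solve 6 (λ d₀ d₁ d₂ x₀ x₁ x₂ →
      x₀ :* (x₀ :* (d₀ :* x₀) :+ (x₁ :* (d₁ :* x₁) :+ x₂ :* (d₂ :* x₂)))
        := d₀ :* (x₀ :* (x₀ :* x₀)) :+ (d₁ :* x₁ :* (x₀ :* x₁) :+ d₂ :* x₂ :* (x₀ :* x₂))) refl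

  diagonal-isotropic-on-axis⇒zero : ∀ {d x : Vec3} → (∀ i → ¬ d i ≈ 0#) →
    (∀ i j → ¬ i ≡ j → x i * x j ≈ 0#) → ⟨ x , (λ i → d i * x i) ⟩ ≈ 0# → ∀ i → x i ≈ 0#
  diagonal-isotropic-on-axis⇒zero d≉0 on-axis isotropic zero =
    diagonal-isotropic-on-first-axis⇒zero (d≉0 zero) (on-axis _ _ (λ ())) (on-axis _ _ (λ ())) isotropic
  diagonal-isotropic-on-axis⇒zero d≉0 on-axis isotropic (suc zero) =
    diagonal-isotropic-on-first-axis⇒zero (d≉0 (suc zero)) (on-axis (suc zero) zero (λ ())) (on-axis _ _ (λ ()))
      (trans (x∙yz≈y∙xz _ _ _) isotropic)
  diagonal-isotropic-on-axis⇒zero d≉0 on-axis isotropic (suc (suc zero)) =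
    diagonal-isotropic-on-first-axis⇒zero (d≉0 (suc (suc zero))) (on-axis (suc (suc zero)) zero (λ ()))
      (on-axis (suc (suc zero)) (suc zero) (λ ())) (trans (sym (x∙yz≈z∙xy _ _ _)) isotropic)

  -- Column i of Sᵀ M S is Sᵀ M sᵢ for the column sᵢ of S; if it vanished,
  -- invertibility of Sᵀ and M would force sᵢ = 0.
  congruent-diagonal≉0 : ∀ S M → Invertible R S → ¬ det3 R M ≈ 0# → IsDiagonal R (congruent S M) →
                         ∀ i → ¬ congruent S M i i ≈ 0#
  congruent-diagonal≉0 S M (T , ST≈I , TS≈I) det≉0 diagonal i Pᵢᵢ≈0 = 1≉0 (begin
    1#                  ≈⟨ idMat-diagonal i ⟨
    idMat R i i         ≈⟨ TS≈I i i ⟨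
    (T ⊛ sᵢ) i          ≈⟨ ⊛-congʳ T {sᵢ} sᵢ≈0 i ⟩
    (T ⊛ (λ _ → 0#)) i  ≈⟨ ⊛-zeroʳ T i ⟩
    0#                  ∎)
    where
    sᵢ : Vec3
    sᵢ k = S k i
    column≈0 : ∀ k → congruent S M k i ≈ 0#
    column≈0 k with k Fin.≟ i
    ... | yes ≡.refl = Pᵢᵢ≈0
    ... | no  k≢i    = diagonal k i k≢i
    sᵢ≈0 : ∀ k → sᵢ k ≈ 0#
    sᵢ≈0 = nonsingular⇒⊛-injective M det≉0 {sᵢ}
             (left-inverse⇒⊛-injective (transpose R S) (transpose R T) (transpose-inverse S T ST≈I)
                                       {M ⊛ sᵢ} column≈0)

  addSquare-not-simultaneously-diagonalizable : ∀ {E u} → Proper R E → Nonzero u → value E u ≈ 0# →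
                                                ¬ SimDiag R E (addSquare E (matrix R E ⊛ u))
  addSquare-not-simultaneously-diagonalizable {E} {u} proper u≢0 isotropic
    (S , S-invertible@(T , ST≈I , _) , P-diagonal , Q-diagonal) = u≢0 u≈0
    where
    A P : Mat3 R
    A = matrix R E
    P = congruent S A
    w v x : Vec3
    w = A ⊛ u
    v = transpose R S ⊛ w
    x = T ⊛ u

    Sx≈u : ∀ i → (S ⊛ x) i ≈ u i
    Sx≈u = left-inverse-⊛ T S ST≈I u

    v≈Px : ∀ i → v i ≈ P i i * x i
    v≈Px i = begin
      v i                           ≈⟨ ⊛-congʳ (transpose R S) (⊛-congʳ A Sx≈u) i ⟨
      (transpose R S ⊛ A ⊛ S ⊛ x) i ≈⟨ congruent-⊛ S A x i ⟨
      (P ⊛ x) i                     ≈⟨ diagonal-⊛ P-diagonal x i ⟩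
      P i i * x i                   ∎

    Pᵢᵢ≉0 : ∀ i → ¬ P i i ≈ 0#
    Pᵢᵢ≉0 = congruent-diagonal≉0 S A S-invertible proper P-diagonal

    -- Q = P + 2vvᵀ is diagonal, so v, and with it x, lies on a coordinate axis.
    x-on-axis : ∀ i j → ¬ i ≡ j → x i * x j ≈ 0#
    x-on-axis i j i≢j = x≉0∧x*y≈0⇒y≈0 (x≉0∧y≉0⇒x*y≉0 (Pᵢᵢ≉0 i) (Pᵢᵢ≉0 j)) (begin
      (P i i * P j j) * (x i * x j)  ≈⟨ interchange _ _ _ _ ⟩
      (P i i * x i) * (P j j * x j)  ≈⟨ *-cong (v≈Px i) (v≈Px j) ⟨
      v i * v j                      ≈⟨ x≉0∧x*y≈0⇒y≈0 (proper⇒two≉0 E proper) two*vᵢvⱼ≈0 ⟩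
      0#                             ∎)
      where
      two*vᵢvⱼ≈0 : two * (v i * v j) ≈ 0#
      two*vᵢvⱼ≈0 = begin
        two * (v i * v j)         ≈⟨ +-identityˡ _ ⟨
        0# + two * (v i * v j)    ≈⟨ +-congʳ (P-diagonal i j i≢j) ⟨
        P i j + two * (v i * v j) ≈⟨ congruent-addSquare E w S i j ⟨
        congruent S (matrix R (addSquare E w)) i j ≈⟨ Q-diagonal i j i≢j ⟩
        0#                        ∎

    x-isotropic : ⟨ x , (λ i → P i i * x i) ⟩ ≈ 0#
    x-isotropic = begin
      ⟨ x , (λ i → P i i * x i) ⟩  ≈⟨ ⟨⟩-congʳ x v≈Px ⟨
      ⟨ x , v ⟩                    ≈⟨ ⟨⊛⟩-transpose S x w ⟨
      ⟨ S ⊛ x , w ⟩                ≈⟨ ⟨⟩-congˡ Sx≈u w ⟩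
      ⟨ u , w ⟩                    ≈⟨ two*value≈⟨u,matrix⊛u⟩ E u ⟨
      two * value E u              ≈⟨ *-congˡ isotropic ⟩
      two * 0#                     ≈⟨ zeroʳ two ⟩
      0#                           ∎

    u≈0 : ∀ i → u i ≈ 0#
    u≈0 i = begin
      u i                 ≈⟨ Sx≈u i ⟨
      (S ⊛ x) i           ≈⟨ ⊛-congʳ S (diagonal-isotropic-on-axis⇒zero Pᵢᵢ≉0 x-on-axis x-isotropic) i ⟩
      (S ⊛ (λ _ → 0#)) i  ≈⟨ ⊛-zeroʳ S i ⟩
      0#                  ∎

mainTheorem8 : {c ℓ : Level} (R : CommutativeRing c ℓ) → IsField R →
    (q : ℕ) → OddPrimePower q → HasSize R q →
    (E : QForm R) → Proper R E →
    Σ (QForm R) λ E' → Proper R E' × ¬ SimDiag R E E'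
mainTheorem8 R isField q _ size E proper =
  addSquare E (matrix R E ⊛ u) ,
  (λ det≈0 → proper (trans (sym (det3-addSquare-isotropic E u isotropic)) det≈0)) ,
  addSquare-not-simultaneously-diagonalizable proper u≢0 isotropic
  where
  open CommutativeRing R using (_≈_; 0#; sym; trans)
  open TernaryForms R
  open FiniteFieldProperties R isField size using (_≟_; ternary-form-isotropic)
  open Diagonalization R isField _≟_ using (addSquare-not-simultaneously-diagonalizable)
  isotropicVector : ∃ λ u → Nonzero u × value E u ≈ 0#
  isotropicVector = ternary-form-isotropic (proper⇒two≉0 E proper) E
  u : Vec3
  u = proj₁ isotropicVector
  u≢0 : Nonzero u
  u≢0 = proj₁ (proj₂ isotropicVector)
  isotropic : value E u ≈ 0#
  isotropic = proj₂ (proj₂ isotropicVector)
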